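{- Let $R$ be a Pr\"ufer domain, let $a,b\in R$, and let $\alpha,r,s\in R$ satisfy $a\alpha=br$ and $b(\alpha-1)=as$. For every $R$-module $M$: (i) if no non-zero element of $M$ is annihilated by $\alpha$, then the formula $\exists y\,(ya=x\wedge yb=0)$ is equivalent in $M$ to $x=0$; (ii) if no non-zero element of $M$ is annihilated by $\alpha-1$, then $\exists y\,(ya=x\wedge yb=0)$ is equivalent in $M$ to $a\mid x\wedge xs=0$; (iii) if $M\alpha=M$, then $a\mid xb$ is equivalent in $M$ to $r\mid x+xb=0$; (iv) if $M(\alpha-1)=M$, then $a\mid xb$ is equivalent in $M$ to $x=x$.
   Context: $c\mid x$ abbreviates $\exists y\,(yc=x)$; $a\mid xb$ abbreviates $\exists y\,(ya=xb)$; $r\mid x+xb=0$ denotes the sum of the pp-formulas $r\mid x$ and $xb=0$, i.e. $\exists x_1,x_2\,(x=x_1+x_2\wedge r\mid x_1\wedge x_2b=0)$. Two formulas are equivalent in $M$ if they define the same subset of $M$. -}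

module Defs where

open import Level using (Level; _⊔_)
open import Data.Nat using (ℕ; zero; suc)
open import Data.Fin using (Fin; zero; suc)
open import Data.Product using (Σ; ∃; _×_; _,_)
open import Data.Sum using (_⊎_)
open import Relation.Nullary using (¬_)
open import Algebra.Bundles using (CommutativeRing)

module _ {r ℓr : Level} (R : CommutativeRing r ℓr) where
  open CommutativeRing R using (Carrier; _≈_; _+_; _*_; 0#; 1#)

  ∑ : (n : ℕ) → (Fin n → Carrier) → Carrier
  ∑ zero    f = 0#
  ∑ (suc n) f = f zero + ∑ n (λ i → f (suc i))

  IsIntegralDomain : Set (r ⊔ ℓr)
  IsIntegralDomain =
    (¬ (1# ≈ 0#)) × (∀ x y → x * y ≈ 0# → (x ≈ 0#) ⊎ (y ≈ 0#))

  -- In a domain, a non-zero f.g. ideal I is invertible (I·I⁻¹ = R for a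
  -- fractional ideal I⁻¹) iff there are a f.g. ideal J = (h 0, ..., h (m-1))
  -- and c ≠ 0 with  I·J = (c):  clearing denominators of I⁻¹ gives J.
  IsInvertibleFGIdeal : (n : ℕ) → (Fin n → Carrier) → Set (r ⊔ ℓr)
  IsInvertibleFGIdeal n g =
    Σ ℕ λ m → Σ (Fin m → Carrier) λ h → Σ Carrier λ c →
      (¬ (c ≈ 0#)) ×
      (∀ i j → Σ Carrier λ t → g i * h j ≈ t * c) ×
      (Σ (Fin n → Fin m → Carrier) λ t →
         c ≈ ∑ n (λ i → ∑ m (λ j → t i j * (g i * h j))))

  IsPruferDomain : Set (r ⊔ ℓr)
  IsPruferDomain =
    IsIntegralDomain ×
    (∀ (n : ℕ) (g : Fin n → Carrier) →
       (Σ (Fin n) λ i → ¬ (g i ≈ 0#)) → IsInvertibleFGIdeal n g)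

-- All four equivalences hold in any module over a commutative ring; the
-- relations  a α = b r  and  b (α − 1) = a s  let one trade a factor a for
-- b (or back) at the cost of a factor α or α − 1, which torsion-freeness
-- by that element cancels and divisibility by it supplies.
module Submission where

open import Defs
open import Level using (Level; _⊔_)
open import Data.Product using (Σ; _×_; _,_)
open import Function.Base using (_$_)
open import Function.Bundles using (_⇔_; mk⇔)
open import Relation.Unary using (Pred)
open import Algebra.Bundles using (CommutativeRing)
open import Algebra.Module.Bundles using (Module)
import Algebra.Properties.Group as GroupProperties
import Relation.Binary.Reasoning.Setoid as SetoidReasoning

module _ {c ℓ m ℓm : Level} {R : CommutativeRing c ℓ} (M : Module R m ℓm) where
  open CommutativeRing R
  open Module M
  open GroupProperties +ᴹ-group using (\\-leftDividesˡ; inverseʳ-unique)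
  open SetoidReasoning ≈ᴹ-setoid

  infix 4 _∣ᴹ_

  _∣ᴹ_ : Carrier → Pred Carrierᴹ (m ⊔ ℓm)
  u ∣ᴹ x = Σ Carrierᴹ λ y → y *ᵣ u ≈ᴹ x

  Ann : Carrier → Pred Carrierᴹ ℓm
  Ann u x = x *ᵣ u ≈ᴹ 0ᴹ

  AnnImage : Carrier → Carrier → Pred Carrierᴹ (m ⊔ ℓm)
  AnnImage a b x = Σ Carrierᴹ λ y → (y *ᵣ a ≈ᴹ x) × Ann b y

  _⊕_ : {p q : Level} → Pred Carrierᴹ p → Pred Carrierᴹ q → Pred Carrierᴹ (m ⊔ ℓm ⊔ p ⊔ q)
  (P ⊕ Q) x = Σ Carrierᴹ λ x₁ → Σ Carrierᴹ λ x₂ → (x ≈ᴹ x₁ +ᴹ x₂) × P x₁ × Q x₂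

  IsTorsionFreeBy : Carrier → Set (m ⊔ ℓm)
  IsTorsionFreeBy u = ∀ y → Ann u y → y ≈ᴹ 0ᴹ

  IsDivisibleBy : Carrier → Set (m ⊔ ℓm)
  IsDivisibleBy u = ∀ x → u ∣ᴹ x

  *ᵣ-exchange : ∀ y {u v w t} → u * v ≈ w * t → y *ᵣ u *ᵣ v ≈ᴹ y *ᵣ w *ᵣ t
  *ᵣ-exchange y {u} {v} {w} {t} uv≈wt = begin
    y *ᵣ u *ᵣ v    ≈⟨ *ᵣ-assoc y u v ⟩
    y *ᵣ (u * v)   ≈⟨ *ᵣ-congˡ uv≈wt ⟩
    y *ᵣ (w * t)   ≈⟨ *ᵣ-assoc y w t ⟨
    y *ᵣ w *ᵣ t    ∎

  annImage-annihilated : ∀ {a b v w x} → a * v ≈ b * w → AnnImage a b x → Ann v x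
  annImage-annihilated {a} {b} {v} {w} {x} av≈bw (y , ya≈x , yb≈0) = begin
    x *ᵣ v        ≈⟨ *ᵣ-congʳ ya≈x ⟨
    y *ᵣ a *ᵣ v   ≈⟨ *ᵣ-exchange y av≈bw ⟩
    y *ᵣ b *ᵣ w   ≈⟨ *ᵣ-congʳ yb≈0 ⟩
    0ᴹ *ᵣ w       ≈⟨ *ᵣ-zeroˡ w ⟩
    0ᴹ            ∎

  ∣ᴹ-*ᵣ : ∀ {a b v w x} → a * v ≈ b * w → w ∣ᴹ x → a ∣ᴹ x *ᵣ b
  ∣ᴹ-*ᵣ {a} {b} {v} {w} {x} av≈bw (y , yw≈x) = y *ᵣ v , (begin
    y *ᵣ v *ᵣ a   ≈⟨ *ᵣ-exchange y (trans (*-comm v a) (trans av≈bw (*-comm b w))) ⟩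
    y *ᵣ w *ᵣ b   ≈⟨ *ᵣ-congʳ yw≈x ⟩
    x *ᵣ b        ∎)

  -ᴹ‿distribˡ-*ᵣ : ∀ z u → -ᴹ (z *ᵣ u) ≈ᴹ (-ᴹ z) *ᵣ u
  -ᴹ‿distribˡ-*ᵣ z u = ≈ᴹ-sym $ inverseʳ-unique (z *ᵣ u) ((-ᴹ z) *ᵣ u) (begin
    z *ᵣ u +ᴹ (-ᴹ z) *ᵣ u   ≈⟨ *ᵣ-distribʳ u z (-ᴹ z) ⟨
    (z +ᴹ -ᴹ z) *ᵣ u        ≈⟨ *ᵣ-congʳ (-ᴹ‿inverseʳ z) ⟩
    0ᴹ *ᵣ u                 ≈⟨ *ᵣ-zeroˡ u ⟩
    0ᴹ                      ∎)

  Ann-difference : ∀ {u x z} → x *ᵣ u ≈ᴹ z *ᵣ u → Ann u (-ᴹ z +ᴹ x)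
  Ann-difference {u} {x} {z} xu≈zu = begin
    (-ᴹ z +ᴹ x) *ᵣ u            ≈⟨ *ᵣ-distribʳ u (-ᴹ z) x ⟩
    (-ᴹ z) *ᵣ u +ᴹ x *ᵣ u       ≈⟨ +ᴹ-cong (≈ᴹ-sym (-ᴹ‿distribˡ-*ᵣ z u)) xu≈zu ⟩
    -ᴹ (z *ᵣ u) +ᴹ z *ᵣ u       ≈⟨ -ᴹ‿inverseˡ (z *ᵣ u) ⟩
    0ᴹ                          ∎

  +ᴹ-Ann-*ᵣ : ∀ {u x₁ x₂} → Ann u x₂ → (x₁ +ᴹ x₂) *ᵣ u ≈ᴹ x₁ *ᵣ u
  +ᴹ-Ann-*ᵣ {u} {x₁} {x₂} x₂u≈0 = begin
    (x₁ +ᴹ x₂) *ᵣ u         ≈⟨ *ᵣ-distribʳ u x₁ x₂ ⟩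
    x₁ *ᵣ u +ᴹ x₂ *ᵣ u      ≈⟨ +ᴹ-congˡ x₂u≈0 ⟩
    x₁ *ᵣ u +ᴹ 0ᴹ           ≈⟨ +ᴹ-identityʳ (x₁ *ᵣ u) ⟩
    x₁ *ᵣ u                 ∎

  annImage⇔≈0 : ∀ {a b α r} → a * α ≈ b * r → IsTorsionFreeBy α →
                ∀ x → AnnImage a b x ⇔ (x ≈ᴹ 0ᴹ)
  annImage⇔≈0 {a} {b} aα≈br torsionFree x = mk⇔
    (λ image → torsionFree x (annImage-annihilated aα≈br image))
    (λ x≈0 → 0ᴹ , ≈ᴹ-trans (*ᵣ-zeroˡ a) (≈ᴹ-sym x≈0) , *ᵣ-zeroˡ b)

  annImage⇔∣ᴹ×Ann : ∀ {a b β s} → b * β ≈ a * s → IsTorsionFreeBy β →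
                    ∀ x → AnnImage a b x ⇔ (a ∣ᴹ x × Ann s x)
  annImage⇔∣ᴹ×Ann {a} {b} {β} {s} bβ≈as torsionFree x = mk⇔
    (λ { image@(y , ya≈x , _) → (y , ya≈x) , annImage-annihilated (sym bβ≈as) image })
    (λ { ((y , ya≈x) , xs≈0) → y , ya≈x , torsionFree (y *ᵣ b) (begin
           y *ᵣ b *ᵣ β   ≈⟨ *ᵣ-exchange y bβ≈as ⟩
           y *ᵣ a *ᵣ s   ≈⟨ *ᵣ-congʳ ya≈x ⟩
           x *ᵣ s        ≈⟨ xs≈0 ⟩
           0ᴹ            ∎) })

  ∣ᴹ-*ᵣ⇔∣ᴹ⊕Ann : ∀ {a b α r} → a * α ≈ b * r → IsDivisibleBy α →
                 ∀ x → a ∣ᴹ x *ᵣ b ⇔ ((r ∣ᴹ_) ⊕ Ann b) x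
  ∣ᴹ-*ᵣ⇔∣ᴹ⊕Ann {a} {b} {α} {r} aα≈br divisible x = mk⇔ split join
    where
    split : a ∣ᴹ x *ᵣ b → ((r ∣ᴹ_) ⊕ Ann b) x
    split (y , ya≈xb) with divisible y
    ... | w , wα≈y = w *ᵣ r , -ᴹ (w *ᵣ r) +ᴹ x
                   , ≈ᴹ-sym (\\-leftDividesˡ (w *ᵣ r) x)
                   , (w , ≈ᴹ-refl)
                   , Ann-difference xb≈wrb
      where
      xb≈wrb : x *ᵣ b ≈ᴹ w *ᵣ r *ᵣ b
      xb≈wrb = begin
        x *ᵣ b        ≈⟨ ya≈xb ⟨
        y *ᵣ a        ≈⟨ *ᵣ-congʳ wα≈y ⟨
        w *ᵣ α *ᵣ a   ≈⟨ *ᵣ-exchange w (trans (*-comm α a) (trans aα≈br (*-comm b r))) ⟩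
        w *ᵣ r *ᵣ b   ∎

    join : ((r ∣ᴹ_) ⊕ Ann b) x → a ∣ᴹ x *ᵣ b
    join (x₁ , x₂ , x≈x₁+x₂ , r∣x₁ , x₂b≈0) with ∣ᴹ-*ᵣ aα≈br r∣x₁
    ... | y , ya≈x₁b = y , (begin
      y *ᵣ a                ≈⟨ ya≈x₁b ⟩
      x₁ *ᵣ b               ≈⟨ +ᴹ-Ann-*ᵣ x₂b≈0 ⟨
      (x₁ +ᴹ x₂) *ᵣ b       ≈⟨ *ᵣ-congʳ x≈x₁+x₂ ⟨
      x *ᵣ b                ∎)

  ∣ᴹ-*ᵣ-of-divisible : ∀ {a b β s} → b * β ≈ a * s → IsDivisibleBy β →
                       ∀ x → a ∣ᴹ x *ᵣ b
  ∣ᴹ-*ᵣ-of-divisible bβ≈as divisible x = ∣ᴹ-*ᵣ (sym bβ≈as) (divisible x)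

lemma4p2 : {ℓ₁ ℓ₂ ℓ₃ ℓ₄ : Level} (R : CommutativeRing ℓ₁ ℓ₂) →
    let open CommutativeRing R in
    IsPruferDomain R →
    (a b α r s : Carrier) →
    a * α ≈ b * r →
    b * (α + (- 1#)) ≈ a * s →
    (M : Module R ℓ₃ ℓ₄) →
    let open Module M in
    ((∀ y → y *ᵣ α ≈ᴹ 0ᴹ → y ≈ᴹ 0ᴹ) →
      ∀ x → (Σ Carrierᴹ λ y → (y *ᵣ a ≈ᴹ x) × (y *ᵣ b ≈ᴹ 0ᴹ)) ⇔ (x ≈ᴹ 0ᴹ))
    ×
    ((∀ y → y *ᵣ (α + (- 1#)) ≈ᴹ 0ᴹ → y ≈ᴹ 0ᴹ) →
      ∀ x → (Σ Carrierᴹ λ y → (y *ᵣ a ≈ᴹ x) × (y *ᵣ b ≈ᴹ 0ᴹ))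
            ⇔ ((Σ Carrierᴹ λ y → y *ᵣ a ≈ᴹ x) × (x *ᵣ s ≈ᴹ 0ᴹ)))
    ×
    ((∀ x → Σ Carrierᴹ λ y → y *ᵣ α ≈ᴹ x) →
      ∀ x → (Σ Carrierᴹ λ y → y *ᵣ a ≈ᴹ x *ᵣ b)
            ⇔ (Σ Carrierᴹ λ x₁ → Σ Carrierᴹ λ x₂ →
                 (x ≈ᴹ x₁ +ᴹ x₂) × (Σ Carrierᴹ λ y → y *ᵣ r ≈ᴹ x₁) × (x₂ *ᵣ b ≈ᴹ 0ᴹ)))
    ×
    ((∀ x → Σ Carrierᴹ λ y → y *ᵣ (α + (- 1#)) ≈ᴹ x) →
      ∀ x → (Σ Carrierᴹ λ y → y *ᵣ a ≈ᴹ x *ᵣ b) ⇔ (x ≈ᴹ x))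
lemma4p2 R _ a b α r s aα≈br bβ≈as M =
    annImage⇔≈0 M aα≈br
  , annImage⇔∣ᴹ×Ann M bβ≈as
  , ∣ᴹ-*ᵣ⇔∣ᴹ⊕Ann M aα≈br
  , λ divisible x → mk⇔ (λ _ → ≈ᴹ-refl) (λ _ → ∣ᴹ-*ᵣ-of-divisible M bβ≈as divisible x)
  where open Module M using (≈ᴹ-refl)
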